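{- Let $\langle A,\succ,1\rangle$ be a G-algebra and put $a\vee b=(a\succ b)\succ b$. The following identities (each quantified over all $x,y\in A$) are equivalent: (G'28) $((x\succ(x\succ y))\succ x)\succ x=1$; (G'29) $(x\succ(x\succ y))\vee x=1$; (G'30) $(x\succ(x\succ y))\succ x=x$.
   Context: A G-algebra is an algebra $\langle A,\succ,1\rangle$ of type $(2,0)$ satisfying for all $x,y,z$: (G1) $1\succ x=x$; (G2) $x\succ 1=1$; (G3) $(x\succ y)\succ y=(y\succ x)\succ x$; (G4) if $x\succ(y\succ z)=1$ then $y\succ(x\succ z)=1$. -}

module Defs where

open import Level using (Level; suc; _⊔_)
open import Relation.Binary.PropositionalEquality using (_≡_)

record GAlgebra (a : Level) : Set (suc a) where
  infixr 5 _≻_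
  field
    Carrier : Set a
    _≻_     : Carrier → Carrier → Carrier
    𝟏       : Carrier
    G1 : ∀ x → 𝟏 ≻ x ≡ x
    G2 : ∀ x → x ≻ 𝟏 ≡ 𝟏
    G3 : ∀ x y → (x ≻ y) ≻ y ≡ (y ≻ x) ≻ x
    G4 : ∀ x y z → x ≻ (y ≻ z) ≡ 𝟏 → y ≻ (x ≻ z) ≡ 𝟏

  _∨_ : Carrier → Carrier → Carrier
  a ∨ b = (a ≻ b) ≻ b

module _ {a : Level} (G : GAlgebra a) where
  open GAlgebra G

  G'28 : Set a
  G'28 = ∀ x y → ((x ≻ (x ≻ y)) ≻ x) ≻ x ≡ 𝟏

  G'29 : Set a
  G'29 = ∀ x y → (x ≻ (x ≻ y)) ∨ x ≡ 𝟏

  G'30 : Set a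
  G'30 = ∀ x y → (x ≻ (x ≻ y)) ≻ x ≡ x

-- The relation x ≻ y ≡ 𝟏 is antisymmetric (by G3) and x ≻ (u ≻ x) ≡ 𝟏 always holds
-- (by G4), so an element u with u ≻ x ≡ 𝟏 and x ≻ (u ≻ x) ≡ 𝟏 forces u ≻ x ≡ x.
module Submission where

open import Defs
open import Level using (Level)
open import Data.Product using (_×_; _,_)
open import Function.Base using (id)
open import Function.Bundles using (_⇔_; mk⇔)
open import Relation.Binary.PropositionalEquality
open ≡-Reasoning

module GAlgebraProperties {a : Level} (G : GAlgebra a) where
  open GAlgebra G

  ≻-refl : ∀ x → x ≻ x ≡ 𝟏
  ≻-refl x = begin
    x ≻ x              ≡⟨ cong (_≻ x) (sym (G1 x)) ⟩
    (𝟏 ≻ x) ≻ x        ≡⟨ sym (G3 x 𝟏) ⟩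
    (x ≻ 𝟏) ≻ 𝟏        ≡⟨ cong (_≻ 𝟏) (G2 x) ⟩
    𝟏 ≻ 𝟏              ≡⟨ G2 𝟏 ⟩
    𝟏                  ∎

  ≻-antisym : ∀ x y → x ≻ y ≡ 𝟏 → y ≻ x ≡ 𝟏 → x ≡ y
  ≻-antisym x y x≻y≡𝟏 y≻x≡𝟏 = begin
    x                  ≡⟨ sym (G1 x) ⟩
    𝟏 ≻ x              ≡⟨ cong (_≻ x) (sym y≻x≡𝟏) ⟩
    (y ≻ x) ≻ x        ≡⟨ sym (G3 x y) ⟩
    (x ≻ y) ≻ y        ≡⟨ cong (_≻ y) x≻y≡𝟏 ⟩
    𝟏 ≻ y              ≡⟨ G1 y ⟩
    y                  ∎

  ≻-weaken : ∀ u x → x ≻ (u ≻ x) ≡ 𝟏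
  ≻-weaken u x = G4 u x x (trans (cong (u ≻_) (≻-refl x)) (G2 u))

  G'29⇒G'30 : G'29 G → G'30 G
  G'29⇒G'30 h x y = ≻-antisym _ _ (h x y) (≻-weaken (x ≻ (x ≻ y)) x)

  G'30⇒G'29 : G'30 G → G'29 G
  G'30⇒G'29 h x y = trans (cong (_≻ x) (h x y)) (≻-refl x)

-- G'28 and G'29 are the same identity, since a ∨ b unfolds to (a ≻ b) ≻ b.
lemma3p1 : ∀ {a : Level} (G : GAlgebra a) →
    (G'28 G ⇔ G'29 G) × (G'29 G ⇔ G'30 G)
lemma3p1 G = mk⇔ id id , mk⇔ G'29⇒G'30 G'30⇒G'29
  where open GAlgebraProperties G
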